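{- Let $s\in\{6,18\}$ (so that $\gcd(48,s)=6$). Then each of the following pairs of circulant graphs is a pair of Type-2 isomorphic circulant graphs with respect to $m=2$: (x) $C_{48}(1,s,23)$ and $C_{48}(s,11,13)$; (y) $C_{48}(3,s,21)$ and $C_{48}(s,9,15)$; (z) $C_{48}(5,s,19)$ and $C_{48}(s,7,17)$.
   Context: For an integer $n\ge 2$ and a set $R\subseteq\{1,\dots,\lfloor n/2\rfloor\}$, the circulant graph $C_n(R)$ has vertex set $\{v_0,\dots,v_{n-1}\}$ (indices modulo $n$), and $v_iv_j$ is an edge iff $i-j\equiv \pm r \pmod n$ for some $r\in R$; we write $C_n(a,b,c)$ for $C_n(\{a,b,c\})$, etc. The reflexive modular reduction of a collection of integers reduces each modulo $n$ to $r'\in\{0,\dots,n-1\}$ and then replaces $r'$ by $n-r'$ whenever $r'>n/2$. For $x$ with $\gcd(n,x)=1$, $xR$ denotes the reflexive modular reduction of $\{xr: r\in R\}$. Given $m>1$ and $0\le t\le n/m-1$, the map $\theta_{n,m,t}$ sends the vertex $v_x$ ($x\in\mathbb{Z}_n$, written $x=qm+j$ with $0\le j\le m-1$) to $u_{x+jtm}$ (subscripts modulo $n$, where $u_0,\dots,u_{n-1}$ are the vertices of $K_n$) and an edge $(v_x,v_{x+s})$ to $(\theta_{n,m,t}(v_x),\theta_{n,m,t}(v_{x+s}))$. Two circulant graphs $C_n(R)$ and $C_n(S)$ are called Type-2 isomorphic with respect to $m$ if: $R\neq S$ and $|R|=|S|\ge 3$; there is $r\in R\cap S$ with $m\mid\gcd(n,r)$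 and $m^3\mid n$; there is $t$ with $1\le t\le n/m-1$ such that $\theta_{n,m,t}$ maps the edge set of $C_n(R)$ exactly onto the edge set of $C_n(S)$ (i.e. $\theta_{n,m,t}(C_n(R))=C_n(S)$); and $S\neq xR$ for every $x$ with $\gcd(x,n)=1$. By convention, if $C_n(R)$ and $C_n(S)$ are Type-2 isomorphic with respect to $m$, then for every positive integer $k$ the graphs $C_{kn}(kR)$ and $C_{kn}(kS)$, where $kR=\{kr:r\in R\}$, are also said to be Type-2 isomorphic with respect to $m$. -}

module Defs where

open import Data.Nat using (ℕ; zero; suc; _+_; _*_; _∸_; _^_; _≤_; _<_; NonZero; _≡ᵇ_; _<ᵇ_)
open import Data.Nat.DivMod using (_%_; _/_; m%n<n)
open import Data.Nat.Divisibility using (_∣_)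
open import Data.Nat.GCD using (gcd)
open import Data.Nat.Coprimality using (Coprime)
open import Data.Bool using (Bool; true; false; _∧_; if_then_else_)
open import Data.Fin using (Fin; toℕ; fromℕ<)
open import Data.Fin.Subset using (Subset; _∈_; ∣_∣)
open import Data.Vec using (tabulate)
open import Data.List using (List; allFin)
open import Data.Bool.ListAction using (any)
open import Data.Product using (Σ; ∃; _×_)
open import Data.Sum using (_⊎_)
open import Relation.Binary.PropositionalEquality using (_≡_; _≢_)

setOf : (n : ℕ) → List ℕ → Subset n
setOf n xs = tabulate (λ i → any (λ x → toℕ i ≡ᵇ x) xs)

ValidConn : (n : ℕ) → Subset n → Set
ValidConn n R = ∀ (i : Fin n) → i ∈ R → (1 ≤ toℕ i × toℕ i ≤ n / 2)
  where instance _ : NonZero 2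
                 _ = _

rred : (n : ℕ) .{{_ : NonZero n}} → ℕ → ℕ
rred n a = if n <ᵇ (a % n) * 2 then n ∸ (a % n) else a % n

-- xR : reflexive modular reduction of {x r : r ∈ R}
mulSet : (n : ℕ) .{{_ : NonZero n}} → ℕ → Subset n → Subset n
mulSet n x R = tabulate (λ j → any (λ i → Data.Vec.lookup R i ∧ (rred n (x * toℕ i) ≡ᵇ toℕ j)) (allFin n))

diffMod : (n : ℕ) .{{_ : NonZero n}} → Fin n → Fin n → ℕ
diffMod n a b = (toℕ a + n ∸ toℕ b) % n

Edge : (n : ℕ) .{{_ : NonZero n}} → Subset n → Fin n → Fin n → Set
Edge n R a b = ∃ λ (r : Fin n) → r ∈ R × (diffMod n a b ≡ toℕ r ⊎ diffMod n b a ≡ toℕ r)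

θ : (n m t : ℕ) .{{_ : NonZero n}} .{{_ : NonZero m}} → Fin n → Fin n
θ n m t x = fromℕ< (m%n<n (toℕ x + (toℕ x % m) * t * m) n)

MapsOnto : (n m t : ℕ) .{{_ : NonZero n}} .{{_ : NonZero m}} → Subset n → Subset n → Set
MapsOnto n m t R S =
  (∀ a b → Edge n R a b → Edge n S (θ n m t a) (θ n m t b)) ×
  (∀ c d → Edge n S c d → ∃ λ a → ∃ λ b → Edge n R a b × θ n m t a ≡ c × θ n m t b ≡ d)

Type2Iso : (n m : ℕ) .{{_ : NonZero n}} .{{_ : NonZero m}} → Subset n → Subset n → Set
Type2Iso n m R S =
  1 < m ×
  ValidConn n R × ValidConn n S ×
  R ≢ S × ∣ R ∣ ≡ ∣ S ∣ × 3 ≤ ∣ R ∣ ×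
  (∃ λ (r : Fin n) → r ∈ R × r ∈ S × m ∣ gcd n (toℕ r)) ×
  m ^ 3 ∣ n ×
  (∃ λ t → 1 ≤ t × t ≤ n / m ∸ 1 × MapsOnto n m t R S) ×
  (∀ x → Coprime x n → S ≢ mulSet n x R)

-- θ = θ_{48,2,6} fixes the even vertices and shifts the odd ones by 12, so it is
-- a bijection whose inverse is θ_{48,2,18}: in general θ_{n,m,t'} inverts θ_{n,m,t}
-- whenever m ∣ n and n ∣ (t + t') m, because θ does not change the residue mod m.
-- That θ carries edges of C₄₈(R) to edges of C₄₈(S), and its inverse carries them
-- back, is then a finite check, as are the remaining conditions; the condition on
-- all multipliers x reduces to the finitely many residues x mod 48, since xR only
-- depends on x mod 48.
module Submission where

open import Defs
open import Data.Nat using (ℕ; _+_; _*_; _∸_; _^_; _<_; _≤_; _≤?_; _<?_; _≡ᵇ_; _<ᵇ_; NonZero)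
open import Data.Nat.Properties using (_≟_)
open import Data.Nat.DivMod using (_%_; _/_; m%n<n; m%n%n≡m%n; %-distribˡ-+; %-distribˡ-*; %-remove-+ʳ; [m+kn]%n≡m%n; m∣n⇒o%n%m≡o%m; m<n⇒m%n≡m)
open import Data.Nat.Divisibility using (_∣_; _∣?_; ∣-trans; m∣m*n; ∣n∣m%n⇒∣m; ∣n⇒∣m*n)
open import Data.Nat.Tactic.RingSolver using (solve-∀)
open import Data.Nat.GCD using (gcd)
open import Data.Nat.Coprimality using (Coprime; coprime?)
open import Data.Bool using (_∧_; if_then_else_)
import Data.Bool.Properties as Bool
open import Data.Fin using (Fin; toℕ; fromℕ<; #_)
open import Data.Fin.Properties using (toℕ-fromℕ<; toℕ-injective; toℕ<n; all?)
open import Data.Fin.Subset using (Subset; _∈_; ∣_∣)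
open import Data.Fin.Subset.Properties using (_∈?_)
open import Data.Vec using (lookup)
open import Data.Vec.Properties using (tabulate-cong) renaming (≡-dec to ≡-decᵛ)
open import Data.List using (_∷_; []; allFin)
open import Data.Bool.ListAction using (or)
open import Data.List.Properties using (map-cong)
open import Data.Product using (_×_; _,_)
open import Data.Sum using (_⊎_; inj₁; inj₂)
open import Function using (_⇔_; mk⇔)
open import Function.Properties.Equivalence using () renaming (sym to ⇔-sym)
open import Relation.Nullary using (Dec; ¬?; _×-dec_; _⊎-dec_; _→-dec_)
open import Relation.Nullary.Decidable using (True; toWitness; map)
open import Relation.Binary.Definitions using (DecidableEquality)
open import Relation.Binary.PropositionalEquality using (_≡_; _≢_; refl; sym; trans; cong; subst; module ≡-Reasoning)

_≟ˢ_ : ∀ {n} → DecidableEquality (Subset n)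
_≟ˢ_ = ≡-decᵛ Bool._≟_

module _ {n : ℕ} .{{_ : NonZero n}} where

  diffFin : Fin n → Fin n → Fin n
  diffFin a b = fromℕ< (m%n<n (toℕ a + n ∸ toℕ b) n)

  Edge⇔diff∈ : (R : Subset n) (a b : Fin n) → Edge n R a b ⇔ (diffFin a b ∈ R ⊎ diffFin b a ∈ R)
  Edge⇔diff∈ R a b = mk⇔ to from
    where
    diff-unique : ∀ x y {r : Fin n} → diffMod n x y ≡ toℕ r → diffFin x y ≡ r
    diff-unique x y e = toℕ-injective (trans (toℕ-fromℕ< _) e)
    to : Edge n R a b → diffFin a b ∈ R ⊎ diffFin b a ∈ R
    to (r , r∈R , inj₁ e) = inj₁ (subst (_∈ R) (sym (diff-unique a b e)) r∈R)
    to (r , r∈R , inj₂ e) = inj₂ (subst (_∈ R) (sym (diff-unique b a e)) r∈R)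
    from : diffFin a b ∈ R ⊎ diffFin b a ∈ R → Edge n R a b
    from (inj₁ d∈R) = diffFin a b , d∈R , inj₁ (sym (toℕ-fromℕ< _))
    from (inj₂ d∈R) = diffFin b a , d∈R , inj₂ (sym (toℕ-fromℕ< _))

  edge? : (R : Subset n) (a b : Fin n) → Dec (Edge n R a b)
  edge? R a b = map (⇔-sym (Edge⇔diff∈ R a b)) (diffFin a b ∈? R ⊎-dec diffFin b a ∈? R)

  EdgePreserving : (Fin n → Fin n) → Subset n → Subset n → Set
  EdgePreserving f R S = ∀ a b → Edge n R a b → Edge n S (f a) (f b)

  edgePreserving? : (f : Fin n → Fin n) (R S : Subset n) → Dec (EdgePreserving f R S)
  edgePreserving? f R S = all? λ a → all? λ b → edge? R a b →-dec edge? S (f a) (f b)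

  validConn? : (R : Subset n) → Dec (ValidConn n R)
  validConn? R = all? λ i → i ∈? R →-dec (1 ≤? toℕ i ×-dec toℕ i ≤? n / 2)

  coprime-% : ∀ {x} → Coprime x n → Coprime (x % n) n
  coprime-% x⊥n (d∣x%n , d∣n) = x⊥n (∣n∣m%n⇒∣m d∣n d∣x%n , d∣n)

  %-*ˡ : ∀ a b → a * b % n ≡ a % n * b % n
  %-*ˡ a b = begin
    a * b % n                ≡⟨ %-distribˡ-* a b n ⟩
    a % n * (b % n) % n      ≡⟨ cong (λ v → v * (b % n) % n) (m%n%n≡m%n a n) ⟨
    a % n % n * (b % n) % n  ≡⟨ %-distribˡ-* (a % n) b n ⟨
    a % n * b % n            ∎
    where open ≡-Reasoning

  rred-cong-% : ∀ {a b} → a % n ≡ b % n → rred n a ≡ rred n b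
  rred-cong-% = cong λ r → if n <ᵇ r * 2 then n ∸ r else r

  mulSet-% : ∀ x R → mulSet n x R ≡ mulSet n (x % n) R
  mulSet-% x R = tabulate-cong λ j → cong or (map-cong (λ i →
    cong (λ v → lookup R i ∧ (v ≡ᵇ toℕ j)) (rred-cong-% (%-*ˡ x (toℕ i)))) (allFin n))

  NoFinMultiplier : Subset n → Subset n → Set
  NoFinMultiplier R S = ∀ (k : Fin n) → Coprime (toℕ k) n → S ≢ mulSet n (toℕ k) R

  noMultiplier-fromFin : ∀ {R S} → NoFinMultiplier R S → ∀ x → Coprime x n → S ≢ mulSet n x R
  noMultiplier-fromFin {R} {S} none x x⊥n S≡xR =
    none k (subst (λ v → Coprime v n) (sym k≡x%n) (coprime-% x⊥n))
           (trans S≡xR (trans (mulSet-% x R) (cong (λ v → mulSet n v R) (sym k≡x%n))))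
    where
    k : Fin n
    k = fromℕ< (m%n<n x n)
    k≡x%n : toℕ k ≡ x % n
    k≡x%n = toℕ-fromℕ< _

  noFinMultiplier? : (R S : Subset n) → Dec (NoFinMultiplier R S)
  noFinMultiplier? R S = all? λ k → coprime? (toℕ k) n →-dec ¬? (S ≟ˢ mulSet n (toℕ k) R)

module _ {n m : ℕ} .{{_ : NonZero n}} .{{_ : NonZero m}} where

  θ-%m : m ∣ n → ∀ t x → toℕ (θ n m t x) % m ≡ toℕ x % m
  θ-%m m∣n t x = begin
    toℕ (θ n m t x) % m                  ≡⟨ cong (_% m) (toℕ-fromℕ< _) ⟩
    (toℕ x + toℕ x % m * t * m) % n % m  ≡⟨ m∣n⇒o%n%m≡o%m m n _ m∣n ⟩
    (toℕ x + toℕ x % m * t * m) % m      ≡⟨ [m+kn]%n≡m%n (toℕ x) (toℕ x % m * t) m ⟩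
    toℕ x % m                            ∎
    where open ≡-Reasoning

  θ-inverse : m ∣ n → ∀ {t t'} → n ∣ (t + t') * m → ∀ x → θ n m t (θ n m t' x) ≡ x
  θ-inverse m∣n {t} {t'} n∣[t+t']m x = toℕ-injective (begin
    toℕ (θ n m t y)                               ≡⟨ toℕ-fromℕ< _ ⟩
    (toℕ y + toℕ y % m * t * m) % n               ≡⟨ cong (λ i → (toℕ y + i * t * m) % n) (θ-%m m∣n t' x) ⟩
    (toℕ y + j * t * m) % n                       ≡⟨ cong (λ v → (v + j * t * m) % n) (toℕ-fromℕ< _) ⟩
    ((a + j * t' * m) % n + j * t * m) % n        ≡⟨ %-distribˡ-+ _ _ n ⟩
    ((a + j * t' * m) % n % n + j * t * m % n) % n ≡⟨ cong (λ v → (v + j * t * m % n) % n) (m%n%n≡m%n _ n) ⟩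
    ((a + j * t' * m) % n + j * t * m % n) % n    ≡⟨ %-distribˡ-+ _ _ n ⟨
    (a + j * t' * m + j * t * m) % n              ≡⟨ cong (_% n) (regroup a j t t' m) ⟩
    (a + j * ((t + t') * m)) % n                  ≡⟨ %-remove-+ʳ a (∣n⇒∣m*n j n∣[t+t']m) ⟩
    a % n                                         ≡⟨ m<n⇒m%n≡m (toℕ<n x) ⟩
    a                                             ∎)
    where
    open ≡-Reasoning
    y : Fin n
    y = θ n m t' x
    a j : ℕ
    a = toℕ x
    j = toℕ x % m
    regroup : ∀ x i u v k → x + i * v * k + i * u * k ≡ x + i * ((u + v) * k)
    regroup = solve-∀

  mapsOnto-byInverse : ∀ {t R S} (g : Fin n → Fin n) → (∀ c → θ n m t (g c) ≡ c) →
                       EdgePreserving (θ n m t) R S → EdgePreserving g S R → MapsOnto n m t R S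
  mapsOnto-byInverse g θ∘g≗id fwd bwd =
    fwd , λ c d cd → g c , g d , bwd c d cd , θ∘g≗id c , θ∘g≗id d

  Type2Certificate : (t t' : ℕ) (r : Fin n) (R S : Subset n) → Set
  Type2Certificate t t' r R S =
    1 < m × ValidConn n R × ValidConn n S × R ≢ S × ∣ R ∣ ≡ ∣ S ∣ × 3 ≤ ∣ R ∣ ×
    (r ∈ R × r ∈ S × m ∣ gcd n (toℕ r)) × m ^ 3 ∣ n ×
    (1 ≤ t × t ≤ n / m ∸ 1 × n ∣ (t + t') * m ×
     EdgePreserving (θ n m t) R S × EdgePreserving (θ n m t') S R) ×
    NoFinMultiplier R S

  type2Certificate? : ∀ t t' r R S → Dec (Type2Certificate t t' r R S)
  type2Certificate? t t' r R S =
    1 <? m ×-dec validConn? R ×-dec validConn? S ×-dec ¬? (R ≟ˢ S) ×-dec ∣ R ∣ ≟ ∣ S ∣ ×-dec 3 ≤? ∣ R ∣ ×-dec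
    (r ∈? R ×-dec r ∈? S ×-dec m ∣? gcd n (toℕ r)) ×-dec m ^ 3 ∣? n ×-dec
    (1 ≤? t ×-dec t ≤? n / m ∸ 1 ×-dec n ∣? (t + t') * m ×-dec
     edgePreserving? (θ n m t) R S ×-dec edgePreserving? (θ n m t') S R) ×-dec
    noFinMultiplier? R S

  type2Iso-fromCertificate : ∀ {t t' r R S} → Type2Certificate t t' r R S → Type2Iso n m R S
  type2Iso-fromCertificate {t} {t'} {r} {R}
    (1<m , validR , validS , R≢S , ∣R∣≡∣S∣ , 3≤∣R∣ , r∈R∩S , m³∣n ,
     (1≤t , t≤n/m-1 , n∣[t+t']m , fwd , bwd) , noMultiplier) =
    1<m , validR , validS , R≢S , ∣R∣≡∣S∣ , 3≤∣R∣ , (r , r∈R∩S) , m³∣n ,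
    (t , 1≤t , t≤n/m-1 , mapsOnto-byInverse (θ n m t') (θ-inverse m∣n n∣[t+t']m) fwd bwd) ,
    noMultiplier-fromFin {R = R} noMultiplier
    where
    m∣n : m ∣ n
    m∣n = ∣-trans (m∣m*n (m ^ 2)) m³∣n

  type2Iso-certified : ∀ t t' r {R S} → True (type2Certificate? t t' r R S) → Type2Iso n m R S
  type2Iso-certified t t' r certificate = type2Iso-fromCertificate (toWitness certificate)

mainTheorem2 : (s : ℕ) → (s ≡ 6 ⊎ s ≡ 18) →
    Type2Iso 48 2 (setOf 48 (1 ∷ s ∷ 23 ∷ [])) (setOf 48 (s ∷ 11 ∷ 13 ∷ [])) ×
    Type2Iso 48 2 (setOf 48 (3 ∷ s ∷ 21 ∷ [])) (setOf 48 (s ∷ 9 ∷ 15 ∷ [])) ×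
    Type2Iso 48 2 (setOf 48 (5 ∷ s ∷ 19 ∷ [])) (setOf 48 (s ∷ 7 ∷ 17 ∷ []))
mainTheorem2 _ (inj₁ refl) =
  type2Iso-certified 6 18 (# 6) _ ,
  type2Iso-certified 6 18 (# 6) _ ,
  type2Iso-certified 6 18 (# 6) _
mainTheorem2 _ (inj₂ refl) =
  type2Iso-certified 6 18 (# 18) _ ,
  type2Iso-certified 6 18 (# 18) _ ,
  type2Iso-certified 6 18 (# 18) _
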